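{- For every nonnegative integer $n$, \[ E_n(x)=n!\sum_{k=0}^{n}\Biggl(\frac{\delta_k}{2^k(n-k)!}\sum_{\substack{0\le l\le n-k\\ l\equiv 0 \ (\mathrm{mod}\ 2)}}\frac{\binom{n-k}{l}E_{n-k-l}\,l!}{2^l\left(\frac{2k+l}{2}\right)!\left(\frac{l}{2}\right)!}\Biggr)T_k(x). \]
   Context: The Euler polynomials $E_m(x)$ are defined by $\frac{2}{e^t+1}e^{xt}=\sum_{m\ge0}E_m(x)\frac{t^m}{m!}$, and the Euler numbers are $E_m=E_m(0)$. $T_k(x)$ denotes the Chebyshev polynomial of the first kind, defined by $T_k(\cos\theta)=\cos(k\theta)$. $\delta_k=1$ if $k=0$ and $\delta_k=2$ if $k>0$. -}

module Defs where

open import Data.Nat as ℕ using (ℕ; zero; suc; _∸_; _%_; _≡ᵇ_)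
open import Data.Nat.Combinatorics using (_C_)
open import Data.Nat using (_!)
open import Data.Integer using (+_)
open import Data.Rational using (ℚ; 0ℚ; 1ℚ; _+_; _*_; _-_; _/_; ½)
open import Data.List using (List; []; _∷_; map; zipWith; foldr; upTo; downFrom)
open import Data.Bool using (if_then_else_)
open import Data.Product using (_×_)

_^ℚ_ : ℚ → ℕ → ℚ
x ^ℚ zero = 1ℚ
x ^ℚ suc m = x * (x ^ℚ m)

fromℕ : ℕ → ℚ
fromℕ n = (+ n) / 1

-- 1/d for positive d (d = 0 mapped to 0; only used with positive d)
inv : ℕ → ℚ
inv zero = 0ℚ
inv (suc d) = (+ 1) / suc d

sumℚ : List ℚ → ℚ
sumℚ = foldr _+_ 0ℚ

sumTo : ℕ → (ℕ → ℚ) → ℚ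
sumTo n f = sumℚ (map f (upTo (suc n)))

-- The generating function
--   2 e^{xt} / (e^t + 1) = Σ E_m(x) t^m / m!
-- is equivalent (compare coefficients of t^m/m! in
-- (e^t + 1) Σ E_m(x) t^m/m! = 2 e^{xt}) to
--   E_m(x) + Σ_{k=0}^{m} C(m,k) E_k(x) = 2 x^m,  i.e.
--   E_m(x) = x^m - ½ Σ_{k=0}^{m-1} C(m,k) E_k(x).
-- eulersRev m x = [E_m(x), E_{m-1}(x), ..., E_0(x)]
eulersRev : ℕ → ℚ → List ℚ
eulersRev zero x = 1ℚ ∷ []
eulersRev (suc m) x =
  ((x ^ℚ suc m) - ½ * sumℚ (zipWith (λ k e → fromℕ (suc m C k) * e) (downFrom (suc m)) prev))
  ∷ prev
  where prev = eulersRev m x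

headOr0 : List ℚ → ℚ
headOr0 [] = 0ℚ
headOr0 (y ∷ _) = y

EulerPoly : ℕ → ℚ → ℚ
EulerPoly m x = headOr0 (eulersRev m x)

EulerNum : ℕ → ℚ
EulerNum m = EulerPoly m 0ℚ

Cheb : ℕ → ℚ → ℚ
Cheb zero x = 1ℚ
Cheb (suc zero) x = x
Cheb (suc (suc k)) x = (fromℕ 2 * x) * Cheb (suc k) x - Cheb k x

δ : ℕ → ℚ
δ zero = 1ℚ
δ (suc _) = fromℕ 2

innerSum : ℕ → ℕ → ℚ
innerSum n k =
  sumTo (n ∸ k) (λ l →
    if l % 2 ≡ᵇ 0
    then fromℕ ((n ∸ k) C l) * EulerNum (n ∸ k ∸ l) * fromℕ (l !)
         * inv ((2 ℕ.^ l) ℕ.* (((2 ℕ.* k ℕ.+ l) ℕ./ 2) !) ℕ.* ((l ℕ./ 2) !))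
    else 0ℚ)

rhs : ℕ → ℚ → ℚ
rhs n x = fromℕ (n !) *
  sumTo n (λ k → (δ k * inv ((2 ℕ.^ k) ℕ.* ((n ∸ k) !)) * innerSum n k) * Cheb k x)

{-# OPTIONS --safe #-}

-- The Euler polynomials have the Appell form E_n(x) = Σ_j C(n,j) E_{n-j} x^j: this sum obeys the
-- recurrence E_{m+1}(x) = x^{m+1} - ½ Σ_{k≤m} C(m+1,k) E_k(x) that determines E, because
-- C(n,k) C(k,j) = C(n,j) C(n-j,k-j) and the recurrence at x = 0 evaluates the resulting inner sums.
-- Since 2x T_0 = 2 T_1 and 2x T_k = T_{k+1} + T_{k-1}, (2x)^j = Σ_k c_{j,k} T_k(x) with
-- c_{k+2i,k} = δ_k C(k+2i,i) and c_{k+2i+1,k} = 0. Substituting x^j = 2^{-j} Σ_k c_{j,k} T_k and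
-- collecting the coefficient of T_k along j = k + l leaves only even l, and cancelling factorials
-- turns each of these terms into the corresponding term of the inner sum.

module Submission where

open import Defs
open import Data.Bool using (if_then_else_)
open import Data.Nat as ℕ using (ℕ; zero; suc; _∸_; _≤_; _<_; z≤n; s≤s; _!; _%_; _/_; _≡ᵇ_; NonZero)
open import Data.Nat.Properties as ℕP using (_!≢0; _!*_!≢0)
open import Data.Nat.Combinatorics using (_C_; nCk≡n!/k![n-k]!; k![n∸k]!∣n!; nCk≡nC[n∸k]; nCk+nC[k+1]≡[n+1]C[k+1]; nCn≡1)
open import Data.Nat.DivMod using (m/n*n≡m; m*n/n≡m)
open import Data.Nat.Induction using (<-rec)
import Data.Nat.Tactic.RingSolver as ℕSolver
import Data.Integer as ℤ
import Data.Integer.Properties as ℤP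
import Data.Integer.Tactic.RingSolver as ℤSolver
open import Data.Rational using (ℚ; 0ℚ; 1ℚ; _+_; _*_; _-_; -_; ½; fromℚᵘ)
open import Data.Rational.Properties as ℚP using (+-*-commutativeRing; toℚᵘ-injective; toℚᵘ-fromℚᵘ; toℚᵘ-homo-+; toℚᵘ-homo-*; fromℚᵘ-cong)
import Data.Rational.Unnormalised as ℚᵘ
import Data.Rational.Unnormalised.Properties as ℚᵘP
open import Data.List using (map; applyUpTo; zipWith; downFrom)
open import Relation.Nullary.Decidable using (dec⇒maybe)
open import Level using (0ℓ)
open import Relation.Binary.PropositionalEquality
open import Tactic.RingSolver using (solve-∀)
import Tactic.RingSolver.Core.AlmostCommutativeRing as ACR

open ≡-Reasoning

ℚ-ring : ACR.AlmostCommutativeRing 0ℓ 0ℓ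
ℚ-ring = ACR.fromCommutativeRing +-*-commutativeRing (λ q → dec⇒maybe (0ℚ ℚP.≟ q))

-- fromℕ n and inv (suc d) are by definition fromℚᵘ of ⟦ n ⟧ᵘ and of mkℚᵘ 1 d, so their arithmetic
-- is transported from ℚᵘ.
private
  ⟦_⟧ᵘ : ℕ → ℚᵘ.ℚᵘ
  ⟦ n ⟧ᵘ = ℚᵘ.mkℚᵘ (ℤ.+ n) 0

fromℚᵘ-+ : ∀ p q → fromℚᵘ (p ℚᵘ.+ q) ≡ fromℚᵘ p + fromℚᵘ q
fromℚᵘ-+ p q = toℚᵘ-injective (ℚᵘP.≃-trans (toℚᵘ-fromℚᵘ (p ℚᵘ.+ q)) (ℚᵘP.≃-sym
  (ℚᵘP.≃-trans (toℚᵘ-homo-+ (fromℚᵘ p) (fromℚᵘ q)) (ℚᵘP.+-cong (toℚᵘ-fromℚᵘ p) (toℚᵘ-fromℚᵘ q)))))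

fromℚᵘ-* : ∀ p q → fromℚᵘ (p ℚᵘ.* q) ≡ fromℚᵘ p * fromℚᵘ q
fromℚᵘ-* p q = toℚᵘ-injective (ℚᵘP.≃-trans (toℚᵘ-fromℚᵘ (p ℚᵘ.* q)) (ℚᵘP.≃-sym
  (ℚᵘP.≃-trans (toℚᵘ-homo-* (fromℚᵘ p) (fromℚᵘ q)) (ℚᵘP.*-cong (toℚᵘ-fromℚᵘ p) (toℚᵘ-fromℚᵘ q)))))

fromℕ-+ : ∀ m n → fromℕ (m ℕ.+ n) ≡ fromℕ m + fromℕ n
fromℕ-+ m n = trans (fromℚᵘ-cong {⟦ m ℕ.+ n ⟧ᵘ} {⟦ m ⟧ᵘ ℚᵘ.+ ⟦ n ⟧ᵘ} (ℚᵘ.*≡* eq)) (fromℚᵘ-+ ⟦ m ⟧ᵘ ⟦ n ⟧ᵘ)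
  where
  eq : ℤ.+ (m ℕ.+ n) ℤ.* ℤ.+ 1 ≡ (ℤ.+ m ℤ.* ℤ.+ 1 ℤ.+ ℤ.+ n ℤ.* ℤ.+ 1) ℤ.* ℤ.+ 1
  eq = trans (cong (ℤ._* ℤ.+ 1) (ℤP.pos-+ m n)) (unit-distrib (ℤ.+ m) (ℤ.+ n))
    where
    unit-distrib : ∀ a b → (a ℤ.+ b) ℤ.* ℤ.+ 1 ≡ (a ℤ.* ℤ.+ 1 ℤ.+ b ℤ.* ℤ.+ 1) ℤ.* ℤ.+ 1
    unit-distrib = ℤSolver.solve-∀

fromℕ-* : ∀ m n → fromℕ (m ℕ.* n) ≡ fromℕ m * fromℕ n
fromℕ-* m n = trans (fromℚᵘ-cong {⟦ m ℕ.* n ⟧ᵘ} {⟦ m ⟧ᵘ ℚᵘ.* ⟦ n ⟧ᵘ} (ℚᵘ.*≡* (cong (ℤ._* ℤ.+ 1) (ℤP.pos-* m n)))) (fromℚᵘ-* ⟦ m ⟧ᵘ ⟦ n ⟧ᵘ)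

fromℕ*fromℕ-cong : ∀ a b c d → a ℕ.* b ≡ c ℕ.* d → fromℕ a * fromℕ b ≡ fromℕ c * fromℕ d
fromℕ*fromℕ-cong a b c d ab≡cd = trans (sym (fromℕ-* a b)) (trans (cong fromℕ ab≡cd) (fromℕ-* c d))

fromℕ-^ : ∀ m j → fromℕ (m ℕ.^ j) ≡ fromℕ m ^ℚ j
fromℕ-^ m zero    = refl
fromℕ-^ m (suc j) = trans (fromℕ-* m (m ℕ.^ j)) (cong (fromℕ m *_) (fromℕ-^ m j))

*-^ℚ : ∀ p q j → (p * q) ^ℚ j ≡ p ^ℚ j * q ^ℚ j
*-^ℚ p q zero    = refl
*-^ℚ p q (suc j) = trans (cong (p * q *_) (*-^ℚ p q j)) (interchange p q (p ^ℚ j) (q ^ℚ j))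
  where
  interchange : ∀ a b c d → a * b * (c * d) ≡ a * c * (b * d)
  interchange = solve-∀ ℚ-ring

inv-* : ∀ m n → inv (m ℕ.* n) ≡ inv m * inv n
inv-* zero    n       = sym (ℚP.*-zeroˡ (inv n))
inv-* (suc m) zero    = trans (cong inv (ℕP.*-zeroʳ m)) (sym (ℚP.*-zeroʳ (inv (suc m))))
inv-* (suc m) (suc n) = trans (fromℚᵘ-cong {ℚᵘ.mkℚᵘ (ℤ.+ 1) (n ℕ.+ m ℕ.* suc n)} {ℚᵘ.mkℚᵘ (ℤ.+ 1) m ℚᵘ.* ℚᵘ.mkℚᵘ (ℤ.+ 1) n} (ℚᵘ.*≡* refl))
  (fromℚᵘ-* (ℚᵘ.mkℚᵘ (ℤ.+ 1) m) (ℚᵘ.mkℚᵘ (ℤ.+ 1) n))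

fromℕ*inv≡1 : ∀ n .{{_ : NonZero n}} → fromℕ n * inv n ≡ 1ℚ
fromℕ*inv≡1 (suc n) = trans (sym (fromℚᵘ-* ⟦ suc n ⟧ᵘ (ℚᵘ.1/ ⟦ suc n ⟧ᵘ)))
  (fromℚᵘ-cong {⟦ suc n ⟧ᵘ ℚᵘ.* ℚᵘ.1/ ⟦ suc n ⟧ᵘ} {⟦ 1 ⟧ᵘ} (ℚᵘP.*-inverseʳ ⟦ suc n ⟧ᵘ))

*-fromℕ*inv : ∀ p n .{{_ : NonZero n}} → p * (fromℕ n * inv n) ≡ p
*-fromℕ*inv p n = trans (cong (p *_) (fromℕ*inv≡1 n)) (ℚP.*-identityʳ p)

inv*[fromℕ*]≡id : ∀ n .{{_ : NonZero n}} p → inv n * (fromℕ n * p) ≡ p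
inv*[fromℕ*]≡id n p = begin
  inv n * (fromℕ n * p) ≡⟨ ℚP.*-assoc (inv n) (fromℕ n) p ⟨
  inv n * fromℕ n * p   ≡⟨ cong (_* p) (trans (ℚP.*-comm (inv n) (fromℕ n)) (fromℕ*inv≡1 n)) ⟩
  1ℚ * p                ≡⟨ ℚP.*-identityˡ p ⟩
  p                     ∎

fromℕ*inv-cross : ∀ a b c d .{{_ : NonZero b}} .{{_ : NonZero d}} →
                  a ℕ.* d ≡ c ℕ.* b → fromℕ a * inv b ≡ fromℕ c * inv d
fromℕ*inv-cross a b c d ad≡cb = begin
  fromℕ a * inv b                        ≡⟨ *-fromℕ*inv _ d ⟨
  fromℕ a * inv b * (fromℕ d * inv d)    ≡⟨ regroup (fromℕ a) (inv b) (fromℕ d) (inv d) ⟩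
  fromℕ a * fromℕ d * (inv b * inv d)    ≡⟨ cong (_* (inv b * inv d)) (fromℕ*fromℕ-cong a d c b ad≡cb) ⟩
  fromℕ c * fromℕ b * (inv b * inv d)    ≡⟨ regroup′ (fromℕ c) (fromℕ b) (inv b) (inv d) ⟩
  fromℕ c * inv d * (fromℕ b * inv b)    ≡⟨ *-fromℕ*inv _ b ⟩
  fromℕ c * inv d                        ∎
  where
  regroup : ∀ p q r s → p * q * (r * s) ≡ p * r * (q * s)
  regroup = solve-∀ ℚ-ring
  regroup′ : ∀ p q r s → p * q * (r * s) ≡ p * s * (q * r)
  regroup′ = solve-∀ ℚ-ring

Σ< : ℕ → (ℕ → ℚ) → ℚ
Σ< zero    f = 0ℚ
Σ< (suc n) f = f 0 + Σ< n (λ i → f (suc i))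

infixr 9 Σ<
syntax Σ< n (λ i → e) = Σ[ i < n ] e

sumℚ-applyUpTo : ∀ n (f : ℕ → ℚ) g → sumℚ (map f (applyUpTo g n)) ≡ Σ[ i < n ] f (g i)
sumℚ-applyUpTo zero    f g = refl
sumℚ-applyUpTo (suc n) f g = cong (f (g 0) +_) (sumℚ-applyUpTo n f (λ i → g (suc i)))

sumTo≡Σ< : ∀ n f → sumTo n f ≡ Σ[ i < suc n ] f i
sumTo≡Σ< n f = sumℚ-applyUpTo (suc n) f (λ i → i)

Σ<-cong : ∀ n {f g : ℕ → ℚ} → (∀ i → i < n → f i ≡ g i) → Σ[ i < n ] f i ≡ Σ[ i < n ] g i
Σ<-cong zero    f≡g = refl
Σ<-cong (suc n) f≡g = cong₂ _+_ (f≡g 0 (s≤s z≤n)) (Σ<-cong n (λ i i<n → f≡g (suc i) (s≤s i<n)))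

Σ<-+ : ∀ n (f g : ℕ → ℚ) → Σ[ i < n ] (f i + g i) ≡ Σ[ i < n ] f i + Σ[ i < n ] g i
Σ<-+ zero    f g = refl
Σ<-+ (suc n) f g = trans (cong (f 0 + g 0 +_) (Σ<-+ n _ _)) (interchange (f 0) (g 0) _ _)
  where
  interchange : ∀ a b c d → a + b + (c + d) ≡ a + c + (b + d)
  interchange = solve-∀ ℚ-ring

*-distribˡ-Σ< : ∀ n c (f : ℕ → ℚ) → c * Σ[ i < n ] f i ≡ Σ[ i < n ] (c * f i)
*-distribˡ-Σ< zero    c f = ℚP.*-zeroʳ c
*-distribˡ-Σ< (suc n) c f = trans (ℚP.*-distribˡ-+ c (f 0) _) (cong (c * f 0 +_) (*-distribˡ-Σ< n c _))

*-distribʳ-Σ< : ∀ n c (f : ℕ → ℚ) → Σ[ i < n ] f i * c ≡ Σ[ i < n ] (f i * c)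
*-distribʳ-Σ< zero    c f = ℚP.*-zeroˡ c
*-distribʳ-Σ< (suc n) c f = trans (ℚP.*-distribʳ-+ c (f 0) _) (cong (f 0 * c +_) (*-distribʳ-Σ< n c _))

Σ<-last : ∀ n (f : ℕ → ℚ) → Σ[ i < suc n ] f i ≡ Σ[ i < n ] f i + f n
Σ<-last zero    f = ℚP.+-comm (f 0) 0ℚ
Σ<-last (suc n) f = trans (cong (f 0 +_) (Σ<-last n _)) (sym (ℚP.+-assoc (f 0) _ _))

Σ<-triangle : ∀ n (f : ℕ → ℕ → ℚ) →
  Σ[ j < n ] Σ[ k < suc j ] f j k ≡ Σ[ k < n ] Σ[ l < n ∸ k ] f (k ℕ.+ l) k
Σ<-triangle zero    f = refl
Σ<-triangle (suc n) f = begin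
  (f 0 0 + 0ℚ) + Σ[ j < n ] (f (suc j) 0 + Σ[ k < suc j ] f (suc j) (suc k))
    ≡⟨ cong (f 0 0 + 0ℚ +_) (Σ<-+ n _ _) ⟩
  (f 0 0 + 0ℚ) + (Σ[ j < n ] f (suc j) 0 + Σ[ j < n ] Σ[ k < suc j ] f (suc j) (suc k))
    ≡⟨ cong (λ s → f 0 0 + 0ℚ + (Σ[ j < n ] f (suc j) 0 + s)) (Σ<-triangle n (λ j k → f (suc j) (suc k))) ⟩
  (f 0 0 + 0ℚ) + (Σ[ j < n ] f (suc j) 0 + Σ[ k < n ] Σ[ l < n ∸ k ] f (suc (k ℕ.+ l)) (suc k))
    ≡⟨ regroup (f 0 0) _ _ ⟩
  (f 0 0 + Σ[ l < n ] f (suc l) 0) + Σ[ k < n ] Σ[ l < n ∸ k ] f (suc (k ℕ.+ l)) (suc k)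
    ∎
  where
  regroup : ∀ a b c → a + 0ℚ + (b + c) ≡ a + b + c
  regroup = solve-∀ ℚ-ring

+-suc-suc : ∀ m n → m ℕ.+ suc (suc n) ≡ suc (suc (m ℕ.+ n))
+-suc-suc m n = trans (ℕP.+-suc m (suc n)) (cong suc (ℕP.+-suc m n))

+-≤⇒≤∸ : ∀ {n j l} → j ℕ.+ l ≤ n → l ≤ n ∸ j
+-≤⇒≤∸ {n} {j} {l} j+l≤n = ℕP.m+n≤o⇒m≤o∸n l (subst (_≤ n) (ℕP.+-comm j l) j+l≤n)

+-<-∸ : ∀ {n j l} → j ≤ n → l < n ∸ j → j ℕ.+ l < n
+-<-∸ {n} {j} j≤n l<n∸j = subst (j ℕ.+ _ <_) (ℕP.m+[n∸m]≡n j≤n) (ℕP.+-monoʳ-< j l<n∸j)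

double : ℕ → ℕ
double zero    = zero
double (suc i) = suc (suc (double i))

double≡+ : ∀ i → double i ≡ i ℕ.+ i
double≡+ zero    = refl
double≡+ (suc i) = cong suc (trans (cong suc (double≡+ i)) (sym (ℕP.+-suc i i)))

data Parity : ℕ → Set where
  even : ∀ i → Parity (double i)
  odd  : ∀ i → Parity (suc (double i))

parity : ∀ l → Parity l
parity zero = even 0
parity (suc l) with parity l
... | even i = odd i
... | odd  i = even (suc i)

double-%2 : ∀ i → double i % 2 ≡ 0
double-%2 zero    = refl
double-%2 (suc i) = double-%2 i

suc-double-%2 : ∀ i → suc (double i) % 2 ≡ 1
suc-double-%2 zero    = refl
suc-double-%2 (suc i) = suc-double-%2 i

[2k+double-i]/2≡k+i : ∀ k i → (2 ℕ.* k ℕ.+ double i) / 2 ≡ k ℕ.+ i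
[2k+double-i]/2≡k+i k i = trans (cong (_/ 2) (trans (cong (2 ℕ.* k ℕ.+_) (double≡+ i)) (twice k i))) (m*n/n≡m (k ℕ.+ i) 2)
  where
  twice : ∀ k i → 2 ℕ.* k ℕ.+ (i ℕ.+ i) ≡ (k ℕ.+ i) ℕ.* 2
  twice = ℕSolver.solve-∀

C-*-factorials : ∀ {n k} → k ≤ n → (n C k) ℕ.* (k ! ℕ.* (n ∸ k) !) ≡ n !
C-*-factorials {n} {k} k≤n = trans (cong (ℕ._* (k ! ℕ.* (n ∸ k) !)) (nCk≡n!/k![n-k]! k≤n)) (m/n*n≡m {{k !* (n ∸ k) !≢0}} (k![n∸k]!∣n! k≤n))

+-C-*-factorials : ∀ a b → ((a ℕ.+ b) C a) ℕ.* (a ! ℕ.* b !) ≡ (a ℕ.+ b) !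
+-C-*-factorials a b =
  subst (λ c → ((a ℕ.+ b) C a) ℕ.* (a ! ℕ.* c !) ≡ (a ℕ.+ b) !) (ℕP.m+n∸m≡n a b) (C-*-factorials (ℕP.m≤m+n a b))

C-*-C : ∀ {n j l} → j ℕ.+ l ≤ n → (n C (j ℕ.+ l)) ℕ.* ((j ℕ.+ l) C j) ≡ (n C j) ℕ.* ((n ∸ j) C l)
C-*-C {n} {j} {l} j+l≤n = ℕP.*-cancelʳ-≡ _ _ (j ! ℕ.* (l ! ℕ.* r !)) (begin
  (n C (j ℕ.+ l)) ℕ.* ((j ℕ.+ l) C j) ℕ.* (j ! ℕ.* (l ! ℕ.* r !))
    ≡⟨ regroup (n C (j ℕ.+ l)) ((j ℕ.+ l) C j) (j !) (l !) (r !) ⟩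
  (n C (j ℕ.+ l)) ℕ.* (((j ℕ.+ l) C j) ℕ.* (j ! ℕ.* l !) ℕ.* r !)
    ≡⟨ cong (λ m → (n C (j ℕ.+ l)) ℕ.* (m ℕ.* r !)) (+-C-*-factorials j l) ⟩
  (n C (j ℕ.+ l)) ℕ.* ((j ℕ.+ l) ! ℕ.* r !)
    ≡⟨ cong (λ m → (n C (j ℕ.+ l)) ℕ.* ((j ℕ.+ l) ! ℕ.* m !)) (ℕP.∸-+-assoc n j l) ⟩
  (n C (j ℕ.+ l)) ℕ.* ((j ℕ.+ l) ! ℕ.* (n ∸ (j ℕ.+ l)) !)
    ≡⟨ C-*-factorials j+l≤n ⟩
  n !
    ≡⟨ C-*-factorials j≤n ⟨
  (n C j) ℕ.* (j ! ℕ.* (n ∸ j) !)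
    ≡⟨ cong (λ m → (n C j) ℕ.* (j ! ℕ.* m)) (C-*-factorials (+-≤⇒≤∸ {n} {j} {l} j+l≤n)) ⟨
  (n C j) ℕ.* (j ! ℕ.* (((n ∸ j) C l) ℕ.* (l ! ℕ.* r !)))
    ≡⟨ regroup′ (n C j) ((n ∸ j) C l) (j !) (l !) (r !) ⟩
  (n C j) ℕ.* ((n ∸ j) C l) ℕ.* (j ! ℕ.* (l ! ℕ.* r !))
    ∎)
  where
  r : ℕ
  r = n ∸ j ∸ l
  instance _ = ℕP.m*n≢0 (j !) (l ! ℕ.* r !) {{j !≢0}} {{l !* r !≢0}}
  j≤n : j ≤ n
  j≤n = ℕP.≤-trans (ℕP.m≤m+n j l) j+l≤n
  regroup : ∀ a b x y z → a ℕ.* b ℕ.* (x ℕ.* (y ℕ.* z)) ≡ a ℕ.* (b ℕ.* (x ℕ.* y) ℕ.* z)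
  regroup = ℕSolver.solve-∀
  regroup′ : ∀ a b x y z → a ℕ.* (x ℕ.* (b ℕ.* (y ℕ.* z))) ≡ a ℕ.* b ℕ.* (x ℕ.* (y ℕ.* z))
  regroup′ = ℕSolver.solve-∀

C-middle : ∀ i → suc (double i) C suc i ≡ suc (double i) C i
C-middle i = trans (nCk≡nC[n∸k] (s≤s (subst (i ≤_) (sym (double≡+ i)) (ℕP.m≤m+n i i))))
                   (cong (suc (double i) C_) (trans (cong (_∸ i) (double≡+ i)) (ℕP.m+n∸n≡m i i)))

2*Pascal : ∀ n i → 2 ℕ.* (n C suc i) ℕ.+ 2 ℕ.* (n C i) ≡ 2 ℕ.* (suc n C suc i)
2*Pascal n i = trans (sym (ℕP.*-distribˡ-+ 2 (n C suc i) (n C i)))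
                     (cong (2 ℕ.*_) (trans (ℕP.+-comm (n C suc i) (n C i)) (nCk+nC[k+1]≡[n+1]C[k+1] n i)))

δℕ : ℕ → ℕ
δℕ zero    = 1
δℕ (suc _) = 2

δ≡fromℕ-δℕ : ∀ k → δ k ≡ fromℕ (δℕ k)
δ≡fromℕ-δℕ zero    = refl
δ≡fromℕ-δℕ (suc k) = refl

chebStep : (ℕ → ℕ) → ℕ → ℕ
chebStep u zero          = u 1
chebStep u (suc zero)    = 2 ℕ.* u 0 ℕ.+ u 2
chebStep u (suc (suc k)) = u (suc k) ℕ.+ u (suc (suc (suc k)))

chebCoeff : ℕ → ℕ → ℕ
chebCoeff zero    zero    = 1
chebCoeff zero    (suc k) = 0
chebCoeff (suc j) k       = chebStep (chebCoeff j) k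

chebCoeff-vanishes : ∀ {j k} → j < k → chebCoeff j k ≡ 0
chebCoeff-vanishes {zero}  {suc k}       _ = refl
chebCoeff-vanishes {suc j} {suc (suc k)} (s≤s j<1+k) =
  cong₂ ℕ._+_ (chebCoeff-vanishes j<1+k) (chebCoeff-vanishes (ℕP.m<n⇒m<1+n (ℕP.m<n⇒m<1+n j<1+k)))

-- The index j is abstracted so that the recursive calls may reach it up to +-suc.
chebCoeff-even : ∀ k i {j} → j ≡ k ℕ.+ double i → chebCoeff j k ≡ δℕ k ℕ.* (j C i)
chebCoeff-even zero          zero    refl = refl
chebCoeff-even zero          (suc i) refl = begin
  chebCoeff (suc (double i)) 1                    ≡⟨ chebCoeff-even 1 i refl ⟩
  2 ℕ.* (suc (double i) C i)                      ≡⟨ cong (suc (double i) C i ℕ.+_) (trans (ℕP.*-identityˡ _) (sym (C-middle i))) ⟩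
  suc (double i) C i ℕ.+ suc (double i) C suc i   ≡⟨ nCk+nC[k+1]≡[n+1]C[k+1] (suc (double i)) i ⟩
  double (suc i) C suc i                          ≡⟨ ℕP.*-identityˡ _ ⟨
  1 ℕ.* (double (suc i) C suc i)                  ∎
chebCoeff-even (suc zero)    zero    refl = refl
chebCoeff-even (suc zero)    (suc i) refl = begin
  2 ℕ.* chebCoeff (double (suc i)) 0 ℕ.+ chebCoeff (double (suc i)) 2
    ≡⟨ cong₂ (λ a b → 2 ℕ.* a ℕ.+ b) (chebCoeff-even 0 (suc i) refl) (chebCoeff-even 2 i refl) ⟩
  2 ℕ.* (1 ℕ.* (double (suc i) C suc i)) ℕ.+ 2 ℕ.* (double (suc i) C i)
    ≡⟨ cong (λ a → 2 ℕ.* a ℕ.+ 2 ℕ.* (double (suc i) C i)) (ℕP.*-identityˡ (double (suc i) C suc i)) ⟩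
  2 ℕ.* (double (suc i) C suc i) ℕ.+ 2 ℕ.* (double (suc i) C i)
    ≡⟨ 2*Pascal (double (suc i)) i ⟩
  2 ℕ.* (suc (double (suc i)) C suc i)
    ∎
chebCoeff-even (suc (suc k)) zero    refl =
  cong₂ ℕ._+_ (chebCoeff-even (suc k) 0 refl)
              (chebCoeff-vanishes (s≤s (s≤s (ℕP.≤-trans (ℕP.≤-reflexive (ℕP.+-identityʳ k)) (ℕP.n≤1+n k)))))
chebCoeff-even (suc (suc k)) (suc i) refl =
  trans (cong₂ ℕ._+_ (chebCoeff-even (suc k) (suc i) refl) (chebCoeff-even (3 ℕ.+ k) i (cong suc (+-suc-suc k (double i)))))
        (2*Pascal (suc (k ℕ.+ double (suc i))) i)

chebCoeff-odd : ∀ k i {j} → j ≡ k ℕ.+ suc (double i) → chebCoeff j k ≡ 0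
chebCoeff-odd zero          zero    refl = refl
chebCoeff-odd zero          (suc i) refl = chebCoeff-odd 1 i refl
chebCoeff-odd (suc zero)    zero    refl = refl
chebCoeff-odd (suc zero)    (suc i) refl =
  cong₂ (λ a b → 2 ℕ.* a ℕ.+ b) (chebCoeff-odd 0 (suc i) refl) (chebCoeff-odd 2 i refl)
chebCoeff-odd (suc (suc k)) zero    refl =
  cong₂ ℕ._+_ (chebCoeff-odd (suc k) 0 refl) (chebCoeff-vanishes (s≤s (s≤s (ℕP.≤-reflexive (ℕP.+-comm k 1)))))
chebCoeff-odd (suc (suc k)) (suc i) refl =
  cong₂ ℕ._+_ (chebCoeff-odd (suc k) (suc i) refl) (chebCoeff-odd (3 ℕ.+ k) i (cong suc (+-suc-suc k (suc (double i)))))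

module _ (x : ℚ) where

  chebStep-Σ< : ∀ N u →
    Σ[ k < suc (suc N) ] (fromℕ (chebStep u k) * Cheb k x)
      ≡ fromℕ 2 * x * Σ[ k < suc N ] (fromℕ (u k) * Cheb k x)
        + (fromℕ (u (suc N)) * Cheb N x + fromℕ (u (suc (suc N))) * Cheb (suc N) x)
  chebStep-Σ< zero u =
    trans (cong (λ c → fromℕ (u 1) * 1ℚ + (c * x + 0ℚ)) (trans (fromℕ-+ (2 ℕ.* u 0) (u 2)) (cong (_+ fromℕ (u 2)) (fromℕ-* 2 (u 0)))))
          (regroup (fromℕ 2) x (fromℕ (u 0)) (fromℕ (u 1)) (fromℕ (u 2)))
    where
    regroup : ∀ t y a b c → b * 1ℚ + ((t * a + c) * y + 0ℚ) ≡ t * y * (a * 1ℚ + 0ℚ) + (b * 1ℚ + c * y)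
    regroup = solve-∀ ℚ-ring
  chebStep-Σ< (suc N) u = begin
    Σ[ k < suc (suc (suc N)) ] (fromℕ (chebStep u k) * T k)
      ≡⟨ Σ<-last (suc (suc N)) (λ k → fromℕ (chebStep u k) * T k) ⟩
    Σ[ k < suc (suc N) ] (fromℕ (chebStep u k) * T k) + fromℕ (u (suc N) ℕ.+ u (3 ℕ.+ N)) * T (suc (suc N))
      ≡⟨ cong₂ _+_ (chebStep-Σ< N u) (cong (_* T (suc (suc N))) (fromℕ-+ (u (suc N)) (u (3 ℕ.+ N)))) ⟩
    fromℕ 2 * x * S + (a * T N + b * T (suc N)) + (a + c) * T (suc (suc N))
      ≡⟨ regroup (fromℕ 2 * x) S a b c (T N) (T (suc N)) ⟩
    fromℕ 2 * x * (S + a * T (suc N)) + (b * T (suc N) + c * T (suc (suc N)))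
      ≡⟨ cong (λ s → fromℕ 2 * x * s + (b * T (suc N) + c * T (suc (suc N)))) (Σ<-last (suc N) (λ k → fromℕ (u k) * T k)) ⟨
    fromℕ 2 * x * Σ[ k < suc (suc N) ] (fromℕ (u k) * T k) + (b * T (suc N) + c * T (suc (suc N)))
      ∎
    where
    T : ℕ → ℚ
    T k = Cheb k x
    S a b c : ℚ
    S = Σ[ k < suc N ] (fromℕ (u k) * T k)
    a = fromℕ (u (suc N))
    b = fromℕ (u (suc (suc N)))
    c = fromℕ (u (3 ℕ.+ N))
    -- T_{N+2} unfolds to 2x T_{N+1} - T_N, which cancels the T_N-term of the boundary.
    regroup : ∀ w s a b c t₀ t₁ →
      w * s + (a * t₀ + b * t₁) + (a + c) * (w * t₁ - t₀) ≡ w * (s + a * t₁) + (b * t₁ + c * (w * t₁ - t₀))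
    regroup = solve-∀ ℚ-ring

  twoX^-chebyshev : ∀ j → (fromℕ 2 * x) ^ℚ j ≡ Σ[ k < suc j ] (fromℕ (chebCoeff j k) * Cheb k x)
  twoX^-chebyshev zero    = refl
  twoX^-chebyshev (suc j) = begin
    fromℕ 2 * x * (fromℕ 2 * x) ^ℚ j
      ≡⟨ cong (fromℕ 2 * x *_) (twoX^-chebyshev j) ⟩
    fromℕ 2 * x * Σ[ k < suc j ] (fromℕ (chebCoeff j k) * Cheb k x)
      ≡⟨ ℚP.+-identityʳ _ ⟨
    fromℕ 2 * x * Σ[ k < suc j ] (fromℕ (chebCoeff j k) * Cheb k x) + 0ℚ
      ≡⟨ cong (fromℕ 2 * x * Σ[ k < suc j ] (fromℕ (chebCoeff j k) * Cheb k x) +_) boundary ⟨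
    fromℕ 2 * x * Σ[ k < suc j ] (fromℕ (chebCoeff j k) * Cheb k x)
      + (fromℕ (chebCoeff j (suc j)) * Cheb j x + fromℕ (chebCoeff j (suc (suc j))) * Cheb (suc j) x)
      ≡⟨ chebStep-Σ< j (chebCoeff j) ⟨
    Σ[ k < suc (suc j) ] (fromℕ (chebCoeff (suc j) k) * Cheb k x)
      ∎
    where
    boundary : fromℕ (chebCoeff j (suc j)) * Cheb j x + fromℕ (chebCoeff j (suc (suc j))) * Cheb (suc j) x ≡ 0ℚ
    boundary rewrite chebCoeff-vanishes (ℕP.n<1+n j) | chebCoeff-vanishes (ℕP.m<n⇒m<1+n (ℕP.n<1+n j)) =
      cong₂ _+_ (ℚP.*-zeroˡ (Cheb j x)) (ℚP.*-zeroˡ (Cheb (suc j) x))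

x^-chebyshev : ∀ x j → x ^ℚ j ≡ Σ[ k < suc j ] (inv (2 ℕ.^ j) * fromℕ (chebCoeff j k) * Cheb k x)
x^-chebyshev x j = begin
  x ^ℚ j                                                          ≡⟨ inv*[fromℕ*]≡id (2 ℕ.^ j) (x ^ℚ j) ⟨
  inv (2 ℕ.^ j) * (fromℕ (2 ℕ.^ j) * x ^ℚ j)                      ≡⟨ cong (λ p → inv (2 ℕ.^ j) * (p * x ^ℚ j)) (fromℕ-^ 2 j) ⟩
  inv (2 ℕ.^ j) * (fromℕ 2 ^ℚ j * x ^ℚ j)                         ≡⟨ cong (inv (2 ℕ.^ j) *_) (*-^ℚ (fromℕ 2) x j) ⟨
  inv (2 ℕ.^ j) * (fromℕ 2 * x) ^ℚ j                              ≡⟨ cong (inv (2 ℕ.^ j) *_) (twoX^-chebyshev x j) ⟩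
  inv (2 ℕ.^ j) * Σ[ k < suc j ] (fromℕ (chebCoeff j k) * Cheb k x) ≡⟨ *-distribˡ-Σ< (suc j) (inv (2 ℕ.^ j)) (λ k → fromℕ (chebCoeff j k) * Cheb k x) ⟩
  Σ[ k < suc j ] (inv (2 ℕ.^ j) * (fromℕ (chebCoeff j k) * Cheb k x)) ≡⟨ Σ<-cong (suc j) (λ k _ → sym (ℚP.*-assoc (inv (2 ℕ.^ j)) (fromℕ (chebCoeff j k)) (Cheb k x))) ⟩
  Σ[ k < suc j ] (inv (2 ℕ.^ j) * fromℕ (chebCoeff j k) * Cheb k x) ∎
  where instance _ = ℕP.m^n≢0 2 j

eulersRev-Σ< : ∀ m x (g : ℕ → ℚ → ℚ) →
  sumℚ (zipWith g (downFrom (suc m)) (eulersRev m x)) ≡ Σ[ k < suc m ] g k (EulerPoly k x)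
eulersRev-Σ< zero    x g = refl
eulersRev-Σ< (suc m) x g = begin
  g (suc m) (EulerPoly (suc m) x) + sumℚ (zipWith g (downFrom (suc m)) (eulersRev m x))
    ≡⟨ cong (g (suc m) (EulerPoly (suc m) x) +_) (eulersRev-Σ< m x g) ⟩
  g (suc m) (EulerPoly (suc m) x) + Σ[ k < suc m ] g k (EulerPoly k x)
    ≡⟨ ℚP.+-comm (g (suc m) (EulerPoly (suc m) x)) _ ⟩
  Σ[ k < suc m ] g k (EulerPoly k x) + g (suc m) (EulerPoly (suc m) x)
    ≡⟨ Σ<-last (suc m) (λ k → g k (EulerPoly k x)) ⟨
  Σ[ k < suc (suc m) ] g k (EulerPoly k x)
    ∎

EulerPoly-suc : ∀ m x →
  EulerPoly (suc m) x ≡ x ^ℚ suc m - ½ * Σ[ k < suc m ] (fromℕ (suc m C k) * EulerPoly k x)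
EulerPoly-suc m x = cong (λ s → x ^ℚ suc m - ½ * s) (eulersRev-Σ< m x (λ k e → fromℕ (suc m C k) * e))

EulerPoly-unique : ∀ x (F : ℕ → ℚ) → F 0 ≡ 1ℚ →
  (∀ m → F (suc m) ≡ x ^ℚ suc m - ½ * Σ[ k < suc m ] (fromℕ (suc m C k) * F k)) →
  ∀ n → F n ≡ EulerPoly n x
EulerPoly-unique x F F₀ F-suc = <-rec (λ n → F n ≡ EulerPoly n x) step
  where
  step : ∀ n → (∀ {k} → k < n → F k ≡ EulerPoly k x) → F n ≡ EulerPoly n x
  step zero    _  = F₀
  step (suc m) IH = begin
    F (suc m)                                                      ≡⟨ F-suc m ⟩
    x ^ℚ suc m - ½ * Σ[ k < suc m ] (fromℕ (suc m C k) * F k)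
      ≡⟨ cong (λ s → x ^ℚ suc m - ½ * s) (Σ<-cong (suc m) (λ k k<1+m → cong (fromℕ (suc m C k) *_) (IH k<1+m))) ⟩
    x ^ℚ suc m - ½ * Σ[ k < suc m ] (fromℕ (suc m C k) * EulerPoly k x) ≡⟨ EulerPoly-suc m x ⟨
    EulerPoly (suc m) x                                            ∎

½*Σ-EulerNum : ∀ s .{{_ : NonZero s}} → ½ * Σ[ l < s ] (fromℕ (s C l) * EulerNum l) ≡ - EulerNum s
½*Σ-EulerNum (suc r) = trans (rearrange (0ℚ ^ℚ r) _) (cong -_ (sym (EulerPoly-suc r 0ℚ)))
  where
  rearrange : ∀ p s → s ≡ - (0ℚ * p - s)
  rearrange = solve-∀ ℚ-ring

appellSum : ℚ → ℕ → ℚ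
appellSum x n = Σ[ j < suc n ] (fromℕ (n C j) * EulerNum (n ∸ j) * x ^ℚ j)

Σ<-C*appellSum : ∀ x n → Σ[ k < n ] (fromℕ (n C k) * appellSum x k)
  ≡ Σ[ j < n ] (x ^ℚ j * fromℕ (n C j) * Σ[ l < n ∸ j ] (fromℕ ((n ∸ j) C l) * EulerNum l))
Σ<-C*appellSum x n = begin
  Σ[ k < n ] (fromℕ (n C k) * appellSum x k)
    ≡⟨ Σ<-cong n (λ k _ → *-distribˡ-Σ< (suc k) (fromℕ (n C k)) (λ j → fromℕ (k C j) * EulerNum (k ∸ j) * x ^ℚ j)) ⟩
  Σ[ k < n ] Σ[ j < suc k ] (fromℕ (n C k) * (fromℕ (k C j) * EulerNum (k ∸ j) * x ^ℚ j))
    ≡⟨ Σ<-triangle n (λ k j → fromℕ (n C k) * (fromℕ (k C j) * EulerNum (k ∸ j) * x ^ℚ j)) ⟩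
  Σ[ j < n ] Σ[ l < n ∸ j ] (fromℕ (n C (j ℕ.+ l)) * (fromℕ ((j ℕ.+ l) C j) * EulerNum (j ℕ.+ l ∸ j) * x ^ℚ j))
    ≡⟨ Σ<-cong n (λ j j<n → Σ<-cong (n ∸ j) (λ l l<n∸j → term j l (ℕP.<⇒≤ (+-<-∸ (ℕP.<⇒≤ j<n) l<n∸j)))) ⟩
  Σ[ j < n ] Σ[ l < n ∸ j ] (x ^ℚ j * fromℕ (n C j) * (fromℕ ((n ∸ j) C l) * EulerNum l))
    ≡⟨ Σ<-cong n (λ j _ → sym (*-distribˡ-Σ< (n ∸ j) (x ^ℚ j * fromℕ (n C j)) (λ l → fromℕ ((n ∸ j) C l) * EulerNum l))) ⟩
  Σ[ j < n ] (x ^ℚ j * fromℕ (n C j) * Σ[ l < n ∸ j ] (fromℕ ((n ∸ j) C l) * EulerNum l))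
    ∎
  where
  term : ∀ j l → j ℕ.+ l ≤ n →
    fromℕ (n C (j ℕ.+ l)) * (fromℕ ((j ℕ.+ l) C j) * EulerNum (j ℕ.+ l ∸ j) * x ^ℚ j)
      ≡ x ^ℚ j * fromℕ (n C j) * (fromℕ ((n ∸ j) C l) * EulerNum l)
  term j l j+l≤n = begin
    fromℕ (n C (j ℕ.+ l)) * (fromℕ ((j ℕ.+ l) C j) * EulerNum (j ℕ.+ l ∸ j) * x ^ℚ j)
      ≡⟨ cong (λ r → fromℕ (n C (j ℕ.+ l)) * (fromℕ ((j ℕ.+ l) C j) * EulerNum r * x ^ℚ j)) (ℕP.m+n∸m≡n j l) ⟩
    fromℕ (n C (j ℕ.+ l)) * (fromℕ ((j ℕ.+ l) C j) * EulerNum l * x ^ℚ j)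
      ≡⟨ regroup (fromℕ (n C (j ℕ.+ l))) (fromℕ ((j ℕ.+ l) C j)) (EulerNum l) (x ^ℚ j) ⟩
    fromℕ (n C (j ℕ.+ l)) * fromℕ ((j ℕ.+ l) C j) * (EulerNum l * x ^ℚ j)
      ≡⟨ cong (_* (EulerNum l * x ^ℚ j)) binomials ⟩
    fromℕ (n C j) * fromℕ ((n ∸ j) C l) * (EulerNum l * x ^ℚ j)
      ≡⟨ regroup′ (fromℕ (n C j)) (fromℕ ((n ∸ j) C l)) (EulerNum l) (x ^ℚ j) ⟩
    x ^ℚ j * fromℕ (n C j) * (fromℕ ((n ∸ j) C l) * EulerNum l)
      ∎
    where
    binomials : fromℕ (n C (j ℕ.+ l)) * fromℕ ((j ℕ.+ l) C j) ≡ fromℕ (n C j) * fromℕ ((n ∸ j) C l)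
    binomials = fromℕ*fromℕ-cong (n C (j ℕ.+ l)) ((j ℕ.+ l) C j) (n C j) ((n ∸ j) C l) (C-*-C {n} {j} {l} j+l≤n)
    regroup : ∀ a b e y → a * (b * e * y) ≡ a * b * (e * y)
    regroup = solve-∀ ℚ-ring
    regroup′ : ∀ a b e y → a * b * (e * y) ≡ y * a * (b * e)
    regroup′ = solve-∀ ℚ-ring

appellSum-suc : ∀ x m → appellSum x (suc m) ≡ x ^ℚ suc m - ½ * Σ[ k < suc m ] (fromℕ (suc m C k) * appellSum x k)
appellSum-suc x m = sym (begin
  x ^ℚ n - ½ * Σ[ k < n ] (fromℕ (n C k) * appellSum x k)
    ≡⟨ cong (λ s → x ^ℚ n - ½ * s) (Σ<-C*appellSum x n) ⟩
  x ^ℚ n - ½ * Σ[ j < n ] (x ^ℚ j * fromℕ (n C j) * binomialSum (n ∸ j))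
    ≡⟨ cong (λ s → x ^ℚ n - s) (*-distribˡ-Σ< n ½ (λ j → x ^ℚ j * fromℕ (n C j) * binomialSum (n ∸ j))) ⟩
  x ^ℚ n - Σ[ j < n ] (½ * (x ^ℚ j * fromℕ (n C j) * binomialSum (n ∸ j)))
    ≡⟨ cong (λ s → x ^ℚ n - s) (Σ<-cong n halve) ⟩
  x ^ℚ n - Σ[ j < n ] (- 1ℚ * H j)
    ≡⟨ cong (λ s → x ^ℚ n - s) (*-distribˡ-Σ< n (- 1ℚ) H) ⟨
  x ^ℚ n - - 1ℚ * Σ[ j < n ] H j
    ≡⟨ rearrange (x ^ℚ n) (Σ[ j < n ] H j) ⟩
  Σ[ j < n ] H j + 1ℚ * 1ℚ * x ^ℚ n
    ≡⟨ cong (λ c → Σ[ j < n ] H j + c * EulerNum 0 * x ^ℚ n) (cong fromℕ (nCn≡1 n)) ⟨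
  Σ[ j < n ] H j + fromℕ (n C n) * EulerNum 0 * x ^ℚ n
    ≡⟨ cong (λ r → Σ[ j < n ] H j + fromℕ (n C n) * EulerNum r * x ^ℚ n) (ℕP.n∸n≡0 n) ⟨
  Σ[ j < n ] H j + H n
    ≡⟨ Σ<-last n H ⟨
  appellSum x n
    ∎)
  where
  n : ℕ
  n = suc m
  H : ℕ → ℚ
  H j = fromℕ (n C j) * EulerNum (n ∸ j) * x ^ℚ j
  binomialSum : ℕ → ℚ
  binomialSum s = Σ[ l < s ] (fromℕ (s C l) * EulerNum l)
  halve : ∀ j → j < n → ½ * (x ^ℚ j * fromℕ (n C j) * binomialSum (n ∸ j)) ≡ - 1ℚ * H j
  halve j j<n = trans (regroup (x ^ℚ j) (fromℕ (n C j)) (binomialSum (n ∸ j)))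
    (trans (cong (x ^ℚ j * fromℕ (n C j) *_) (½*Σ-EulerNum (n ∸ j) {{ℕ.>-nonZero (ℕP.m<n⇒0<n∸m j<n)}}))
           (regroup′ (x ^ℚ j) (fromℕ (n C j)) (EulerNum (n ∸ j))))
    where
    regroup : ∀ y c s → ½ * (y * c * s) ≡ y * c * (½ * s)
    regroup = solve-∀ ℚ-ring
    regroup′ : ∀ y c e → y * c * (- e) ≡ - 1ℚ * (c * e * y)
    regroup′ = solve-∀ ℚ-ring
  rearrange : ∀ p s → p - - 1ℚ * s ≡ s + 1ℚ * 1ℚ * p
  rearrange = solve-∀ ℚ-ring

EulerPoly-appell : ∀ n x → EulerPoly n x ≡ appellSum x n
EulerPoly-appell n x = sym (EulerPoly-unique x (appellSum x) refl (appellSum-suc x) n)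

-- Cross-multiplied, this says C(n,j) d C(j,i) / 2^j = n! d / (2^k (n-k)!) · C(n-k,l) l! / (2^l (k+i)! i!).
weight-cross : ∀ {n} d k i → k ℕ.+ double i ≤ n → let l = double i ; j = k ℕ.+ l in
  (n C j) ℕ.* (d ℕ.* (j C i)) ℕ.* ((2 ℕ.^ k ℕ.* (n ∸ k) !) ℕ.* (2 ℕ.^ l ℕ.* (k ℕ.+ i) ! ℕ.* i !))
    ≡ n ! ℕ.* d ℕ.* ((n ∸ k) C l) ℕ.* l ! ℕ.* 2 ℕ.^ j
weight-cross {n} d k i j≤n = ℕP.*-cancelʳ-≡ _ _ (r !) {{r !≢0}} (begin
  (n C j) ℕ.* (d ℕ.* (j C i)) ℕ.* ((2 ℕ.^ k ℕ.* (n ∸ k) !) ℕ.* (2 ℕ.^ l ℕ.* (k ℕ.+ i) ! ℕ.* i !)) ℕ.* r !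
    ≡⟨ regroup (n C j) d (j C i) (2 ℕ.^ k) ((n ∸ k) !) (2 ℕ.^ l) ((k ℕ.+ i) !) (i !) (r !) ⟩
  (n C j) ℕ.* ((j C i) ℕ.* (i ! ℕ.* (k ℕ.+ i) !) ℕ.* r !) ℕ.* W
    ≡⟨ cong (λ m → (n C j) ℕ.* (m ℕ.* r !) ℕ.* W) j!-split ⟩
  (n C j) ℕ.* (j ! ℕ.* r !) ℕ.* W
    ≡⟨ cong (ℕ._* W) (C-*-factorials j≤n) ⟩
  n ! ℕ.* W
    ≡⟨ cong (λ m → n ! ℕ.* (d ℕ.* 2 ℕ.^ k ℕ.* 2 ℕ.^ l ℕ.* m)) (C-*-factorials l≤n∸k) ⟨
  n ! ℕ.* (d ℕ.* 2 ℕ.^ k ℕ.* 2 ℕ.^ l ℕ.* (((n ∸ k) C l) ℕ.* (l ! ℕ.* (n ∸ k ∸ l) !)))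
    ≡⟨ cong (λ m → n ! ℕ.* (d ℕ.* 2 ℕ.^ k ℕ.* 2 ℕ.^ l ℕ.* (((n ∸ k) C l) ℕ.* (l ! ℕ.* m !)))) (ℕP.∸-+-assoc n k l) ⟩
  n ! ℕ.* (d ℕ.* 2 ℕ.^ k ℕ.* 2 ℕ.^ l ℕ.* (((n ∸ k) C l) ℕ.* (l ! ℕ.* r !)))
    ≡⟨ regroup′ (n !) d (2 ℕ.^ k) (2 ℕ.^ l) ((n ∸ k) C l) (l !) (r !) ⟩
  n ! ℕ.* d ℕ.* ((n ∸ k) C l) ℕ.* l ! ℕ.* (2 ℕ.^ k ℕ.* 2 ℕ.^ l) ℕ.* r !
    ≡⟨ cong (λ m → n ! ℕ.* d ℕ.* ((n ∸ k) C l) ℕ.* l ! ℕ.* m ℕ.* r !) (ℕP.^-distribˡ-+-* 2 k l) ⟨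
  n ! ℕ.* d ℕ.* ((n ∸ k) C l) ℕ.* l ! ℕ.* 2 ℕ.^ j ℕ.* r !
    ∎)
  where
  l j r W : ℕ
  l = double i
  j = k ℕ.+ l
  r = n ∸ j
  W = d ℕ.* 2 ℕ.^ k ℕ.* 2 ℕ.^ l ℕ.* (n ∸ k) !
  l≤n∸k : l ≤ n ∸ k
  l≤n∸k = +-≤⇒≤∸ j≤n
  j!-split : (j C i) ℕ.* (i ! ℕ.* (k ℕ.+ i) !) ≡ j !
  j!-split = subst (λ m → (m C i) ℕ.* (i ! ℕ.* (k ℕ.+ i) !) ≡ m !) i+[k+i]≡j (+-C-*-factorials i (k ℕ.+ i))
    where
    i+[k+i]≡j : i ℕ.+ (k ℕ.+ i) ≡ j
    i+[k+i]≡j = trans (swap i k) (cong (k ℕ.+_) (sym (double≡+ i)))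
      where
      swap : ∀ i k → i ℕ.+ (k ℕ.+ i) ≡ k ℕ.+ (i ℕ.+ i)
      swap = ℕSolver.solve-∀
  regroup : ∀ c d b p f q g h e → c ℕ.* (d ℕ.* b) ℕ.* ((p ℕ.* f) ℕ.* (q ℕ.* g ℕ.* h)) ℕ.* e
                                   ≡ c ℕ.* (b ℕ.* (h ℕ.* g) ℕ.* e) ℕ.* (d ℕ.* p ℕ.* q ℕ.* f)
  regroup = ℕSolver.solve-∀
  regroup′ : ∀ a d p q b f e → a ℕ.* (d ℕ.* p ℕ.* q ℕ.* (b ℕ.* (f ℕ.* e))) ≡ a ℕ.* d ℕ.* b ℕ.* f ℕ.* (p ℕ.* q) ℕ.* e
  regroup′ = ℕSolver.solve-∀

innerSummand : ℕ → ℕ → ℕ → ℚ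
innerSummand n k l =
  if l % 2 ≡ᵇ 0
  then fromℕ ((n ∸ k) C l) * EulerNum (n ∸ k ∸ l) * fromℕ (l !)
       * inv ((2 ℕ.^ l) ℕ.* (((2 ℕ.* k ℕ.+ l) / 2) !) ℕ.* ((l / 2) !))
  else 0ℚ

innerSum≡Σ< : ∀ n k → innerSum n k ≡ Σ[ l < suc (n ∸ k) ] innerSummand n k l
innerSum≡Σ< n k = sumTo≡Σ< (n ∸ k) (innerSummand n k)

innerSummand-odd : ∀ n k i → innerSummand n k (suc (double i)) ≡ 0ℚ
innerSummand-odd n k i rewrite suc-double-%2 i = refl

innerSummand-even : ∀ n k i → innerSummand n k (double i)
  ≡ fromℕ ((n ∸ k) C double i) * EulerNum (n ∸ (k ℕ.+ double i)) * fromℕ (double i !)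
    * inv (2 ℕ.^ double i ℕ.* (k ℕ.+ i) ! ℕ.* i !)
innerSummand-even n k i
  rewrite double-%2 i | [2k+double-i]/2≡k+i k i | [2k+double-i]/2≡k+i 0 i | ℕP.∸-+-assoc n k (double i) = refl

chebyshevWeight : ∀ n k l → k ℕ.+ l ≤ n →
  fromℕ (n C (k ℕ.+ l)) * EulerNum (n ∸ (k ℕ.+ l)) * (inv (2 ℕ.^ (k ℕ.+ l)) * fromℕ (chebCoeff (k ℕ.+ l) k))
    ≡ fromℕ (n !) * (δ k * inv (2 ℕ.^ k ℕ.* (n ∸ k) !)) * innerSummand n k l
chebyshevWeight n k l k+l≤n with parity l
... | odd i rewrite chebCoeff-odd k i refl | innerSummand-odd n k i =
  annihilate (fromℕ (n C (k ℕ.+ l))) (EulerNum (n ∸ (k ℕ.+ l))) (inv (2 ℕ.^ (k ℕ.+ l))) (fromℕ (n !) * (δ k * inv (2 ℕ.^ k ℕ.* (n ∸ k) !)))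
  where
  annihilate : ∀ a b c d → a * b * (c * 0ℚ) ≡ d * 0ℚ
  annihilate = solve-∀ ℚ-ring
... | even i = begin
  fromℕ (n C j) * e * (inv (2 ℕ.^ j) * fromℕ (chebCoeff j k))
    ≡⟨ cong (λ c → fromℕ (n C j) * e * (inv (2 ℕ.^ j) * fromℕ c)) (chebCoeff-even k i refl) ⟩
  fromℕ (n C j) * e * (inv (2 ℕ.^ j) * fromℕ (δℕ k ℕ.* (j C i)))
    ≡⟨ regroup (fromℕ (n C j)) e (inv (2 ℕ.^ j)) (fromℕ (δℕ k ℕ.* (j C i))) ⟩
  fromℕ (n C j) * fromℕ (δℕ k ℕ.* (j C i)) * inv (2 ℕ.^ j) * e
    ≡⟨ cong (λ q → q * inv (2 ℕ.^ j) * e) (fromℕ-* (n C j) (δℕ k ℕ.* (j C i))) ⟨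
  fromℕ ((n C j) ℕ.* (δℕ k ℕ.* (j C i))) * inv (2 ℕ.^ j) * e
    ≡⟨ cong (_* e) (fromℕ*inv-cross ((n C j) ℕ.* (δℕ k ℕ.* (j C i))) (2 ℕ.^ j) (n ! ℕ.* δℕ k ℕ.* ((n ∸ k) C l) ℕ.* l !) (A ℕ.* Q)
                                     (weight-cross (δℕ k) k i k+l≤n)) ⟩
  fromℕ (n ! ℕ.* δℕ k ℕ.* ((n ∸ k) C l) ℕ.* l !) * inv (A ℕ.* Q) * e
    ≡⟨ cong₂ (λ p q → p * q * e) expand (inv-* A Q) ⟩
  fromℕ (n !) * fromℕ (δℕ k) * fromℕ ((n ∸ k) C l) * fromℕ (l !) * (inv A * inv Q) * e
    ≡⟨ regroup′ (fromℕ (n !)) (fromℕ (δℕ k)) (fromℕ ((n ∸ k) C l)) (fromℕ (l !)) (inv A) (inv Q) e ⟩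
  fromℕ (n !) * (fromℕ (δℕ k) * inv A) * (fromℕ ((n ∸ k) C l) * e * fromℕ (l !) * inv Q)
    ≡⟨ cong₂ (λ p q → fromℕ (n !) * (p * inv A) * q) (δ≡fromℕ-δℕ k) (innerSummand-even n k i) ⟨
  fromℕ (n !) * (δ k * inv A) * innerSummand n k l
    ∎
  where
  j A Q : ℕ
  j = k ℕ.+ l
  A = 2 ℕ.^ k ℕ.* (n ∸ k) !
  Q = 2 ℕ.^ l ℕ.* (k ℕ.+ i) ! ℕ.* i !
  e : ℚ
  e = EulerNum (n ∸ j)
  instance
    _ = ℕP.m^n≢0 2 j
    _ = ℕP.m*n≢0 A Q {{ℕP.m*n≢0 (2 ℕ.^ k) ((n ∸ k) !) {{ℕP.m^n≢0 2 k}} {{(n ∸ k) !≢0}}}}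
                     {{ℕP.m*n≢0 (2 ℕ.^ l ℕ.* (k ℕ.+ i) !) (i !) {{ℕP.m*n≢0 (2 ℕ.^ l) ((k ℕ.+ i) !) {{ℕP.m^n≢0 2 l}} {{(k ℕ.+ i) !≢0}}}} {{i !≢0}}}}
  expand : fromℕ (n ! ℕ.* δℕ k ℕ.* ((n ∸ k) C l) ℕ.* l !) ≡ fromℕ (n !) * fromℕ (δℕ k) * fromℕ ((n ∸ k) C l) * fromℕ (l !)
  expand = trans (fromℕ-* (n ! ℕ.* δℕ k ℕ.* ((n ∸ k) C l)) (l !))
             (cong (_* fromℕ (l !)) (trans (fromℕ-* (n ! ℕ.* δℕ k) ((n ∸ k) C l)) (cong (_* fromℕ ((n ∸ k) C l)) (fromℕ-* (n !) (δℕ k)))))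
  regroup : ∀ c e w t → c * e * (w * t) ≡ c * t * w * e
  regroup = solve-∀ ℚ-ring
  regroup′ : ∀ f d b g a q e → f * d * b * g * (a * q) * e ≡ f * (d * a) * (b * e * g * q)
  regroup′ = solve-∀ ℚ-ring

chebyshevCoefficient : ∀ n x k → k ≤ n →
  Σ[ l < suc n ∸ k ] (fromℕ (n C (k ℕ.+ l)) * EulerNum (n ∸ (k ℕ.+ l)) * (inv (2 ℕ.^ (k ℕ.+ l)) * fromℕ (chebCoeff (k ℕ.+ l) k) * Cheb k x))
    ≡ fromℕ (n !) * (δ k * inv (2 ℕ.^ k ℕ.* (n ∸ k) !) * innerSum n k * Cheb k x)
chebyshevCoefficient n x k k≤n = begin
  Σ[ l < suc n ∸ k ] (fromℕ (n C (k ℕ.+ l)) * EulerNum (n ∸ (k ℕ.+ l)) * (inv (2 ℕ.^ (k ℕ.+ l)) * fromℕ (chebCoeff (k ℕ.+ l) k) * T))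
    ≡⟨ Σ<-cong (suc n ∸ k) (λ l l<1+n∸k → trans (regroup (fromℕ (n C (k ℕ.+ l))) (EulerNum (n ∸ (k ℕ.+ l))) (inv (2 ℕ.^ (k ℕ.+ l))) (fromℕ (chebCoeff (k ℕ.+ l) k)) T) (cong (_* T) (chebyshevWeight n k l (ℕP.≤-pred (+-<-∸ (ℕP.m≤n⇒m≤1+n k≤n) l<1+n∸k))))) ⟩
  Σ[ l < suc n ∸ k ] (K * innerSummand n k l * T)
    ≡⟨ *-distribʳ-Σ< (suc n ∸ k) T (λ l → K * innerSummand n k l) ⟨
  Σ[ l < suc n ∸ k ] (K * innerSummand n k l) * T
    ≡⟨ cong (_* T) (*-distribˡ-Σ< (suc n ∸ k) K (innerSummand n k)) ⟨
  K * Σ[ l < suc n ∸ k ] innerSummand n k l * T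
    ≡⟨ cong (λ m → K * Σ< m (innerSummand n k) * T) (ℕP.+-∸-assoc 1 k≤n) ⟩
  K * Σ[ l < suc (n ∸ k) ] innerSummand n k l * T
    ≡⟨ cong (λ s → K * s * T) (innerSum≡Σ< n k) ⟨
  K * innerSum n k * T
    ≡⟨ regroup′ (fromℕ (n !)) (δ k * inv (2 ℕ.^ k ℕ.* (n ∸ k) !)) (innerSum n k) T ⟩
  fromℕ (n !) * (δ k * inv (2 ℕ.^ k ℕ.* (n ∸ k) !) * innerSum n k * T)
    ∎
  where
  T K : ℚ
  T = Cheb k x
  K = fromℕ (n !) * (δ k * inv (2 ℕ.^ k ℕ.* (n ∸ k) !))
  regroup : ∀ a b c d t → a * b * (c * d * t) ≡ a * b * (c * d) * t
  regroup = solve-∀ ℚ-ring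
  regroup′ : ∀ f d s t → f * d * s * t ≡ f * (d * s * t)
  regroup′ = solve-∀ ℚ-ring

mainTheorem2 : (n : ℕ) (x : ℚ) → EulerPoly n x ≡ rhs n x
mainTheorem2 n x = begin
  EulerPoly n x
    ≡⟨ EulerPoly-appell n x ⟩
  Σ[ j < suc n ] (c j * x ^ℚ j)
    ≡⟨ Σ<-cong (suc n) (λ j _ → trans (cong (c j *_) (x^-chebyshev x j)) (*-distribˡ-Σ< (suc j) (c j) (λ k → w j k * Cheb k x))) ⟩
  Σ[ j < suc n ] Σ[ k < suc j ] (c j * (w j k * Cheb k x))
    ≡⟨ Σ<-triangle (suc n) (λ j k → c j * (w j k * Cheb k x)) ⟩
  Σ[ k < suc n ] Σ[ l < suc n ∸ k ] (c (k ℕ.+ l) * (w (k ℕ.+ l) k * Cheb k x))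
    ≡⟨ Σ<-cong (suc n) (λ k k<1+n → chebyshevCoefficient n x k (ℕP.≤-pred k<1+n)) ⟩
  Σ[ k < suc n ] (fromℕ (n !) * rhsSummand k)
    ≡⟨ *-distribˡ-Σ< (suc n) (fromℕ (n !)) rhsSummand ⟨
  fromℕ (n !) * Σ[ k < suc n ] rhsSummand k
    ≡⟨ cong (fromℕ (n !) *_) (sumTo≡Σ< n rhsSummand) ⟨
  rhs n x
    ∎
  where
  c : ℕ → ℚ
  c j = fromℕ (n C j) * EulerNum (n ∸ j)
  w : ℕ → ℕ → ℚ
  w j k = inv (2 ℕ.^ j) * fromℕ (chebCoeff j k)
  rhsSummand : ℕ → ℚ
  rhsSummand k = δ k * inv (2 ℕ.^ k ℕ.* (n ∸ k) !) * innerSum n k * Cheb k x
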